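{- Let $V$ be a finite set and $\varphi:2^V\to\mathbb{R}$ with $\varphi(\emptyset)=0$. Then $\varphi$ is strongly submodular if and only if $\sum_{U,W\subseteq V}x_Ux_W\,\varphi(U\cup W)\le0$ for every vector $x\in\mathbb{R}^{2^V}$ with $\sum_{U\subseteq V}x_U=0$ (i.e. the union matrix $(\varphi(U\cup W))_{U,W\subseteq V}$ is of negative type).
   Context: $\varphi$ is strongly submodular if for every $n\ge1$ and all $A_0,A_1,\dots,A_n\subseteq V$, $\sum_{K\subseteq\{1,\dots,n\}}(-1)^{|K|}\varphi\big(A_0\cup\bigcup_{i\in K}A_i\big)\le0$. -}

module Defs where

open import Level using (Level; suc; zero)
open import Data.Nat as ℕ using (ℕ)
open import Data.Fin using (Fin)
import Data.Fin as F
open import Data.Bool using (Bool; true; false; if_then_else_)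
open import Data.Vec using (Vec; []; _∷_)
open import Data.List using (List; []; _∷_; map; _++_; foldr)
open import Data.Fin.Subset using (Subset; _∪_; ⊥; ∣_∣; inside; outside)
open import Data.Product using (Σ; _×_; _,_)
open import Data.Sum using (_⊎_)
open import Relation.Nullary using (¬_)
open import Relation.Binary.PropositionalEquality using (_≡_)

-- The real numbers, given axiomatically as a (Dedekind-)complete ordered
-- field.  Statements quantify over every such structure (which is unique
-- up to isomorphism), so this is "ℝ".
record RealField : Set₁ where
  infixl 6 _+_
  infixl 7 _*_
  infix  4 _≤_
  field
    ℝ    : Set
    0ℝ 1ℝ : ℝ
    _+_ _*_ : ℝ → ℝ → ℝ
    -_   : ℝ → ℝ
    _≤_  : ℝ → ℝ → Set
    +-assoc : ∀ a b c → (a + b) + c ≡ a + (b + c)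
    +-comm  : ∀ a b → a + b ≡ b + a
    +-idˡ   : ∀ a → 0ℝ + a ≡ a
    +-invˡ  : ∀ a → (- a) + a ≡ 0ℝ
    *-assoc : ∀ a b c → (a * b) * c ≡ a * (b * c)
    *-comm  : ∀ a b → a * b ≡ b * a
    *-idˡ   : ∀ a → 1ℝ * a ≡ a
    distribˡ : ∀ a b c → a * (b + c) ≡ a * b + a * c
    0≢1     : ¬ (0ℝ ≡ 1ℝ)
    *-inv   : ∀ a → ¬ (a ≡ 0ℝ) → Σ ℝ (λ b → b * a ≡ 1ℝ)
    ≤-refl    : ∀ a → a ≤ a
    ≤-trans   : ∀ {a b c} → a ≤ b → b ≤ c → a ≤ c
    ≤-antisym : ∀ {a b} → a ≤ b → b ≤ a → a ≡ b
    ≤-total   : ∀ a b → a ≤ b ⊎ b ≤ a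
    +-mono-≤  : ∀ {a b} c → a ≤ b → a + c ≤ b + c
    *-nonneg  : ∀ {a b} → 0ℝ ≤ a → 0ℝ ≤ b → 0ℝ ≤ a * b
    sup : (P : ℝ → Set) → Σ ℝ P → Σ ℝ (λ u → ∀ a → P a → a ≤ u) →
          Σ ℝ (λ s → (∀ a → P a → a ≤ s) × (∀ u → (∀ a → P a → a ≤ u) → s ≤ u))

allSubsets : (n : ℕ) → List (Subset n)
allSubsets ℕ.zero    = [] ∷ []
allSubsets (ℕ.suc n) = map (inside ∷_) (allSubsets n) ++ map (outside ∷_) (allSubsets n)

unionOver : ∀ {n k} → (Fin k → Subset n) → Subset k → Subset n
unionOver {k = ℕ.zero}  A []      = ⊥
unionOver {k = ℕ.suc k} A (b ∷ K) =
  (if b then A F.zero else ⊥) ∪ unionOver (λ i → A (F.suc i)) K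

module _ (R : RealField) where
  open RealField R

  sumL : {A : Set} → List A → (A → ℝ) → ℝ
  sumL xs f = foldr (λ a r → f a + r) 0ℝ xs

  sumSub : (n : ℕ) → (Subset n → ℝ) → ℝ
  sumSub n f = sumL (allSubsets n) f

  signPow : ℕ → ℝ
  signPow ℕ.zero    = 1ℝ
  signPow (ℕ.suc m) = (- 1ℝ) * signPow m

  -- strong submodularity (for every k ≥ 1, written k = suc m)
  StronglySubmodular : (n : ℕ) → (Subset n → ℝ) → Set
  StronglySubmodular n φ =
    (m : ℕ) (A₀ : Subset n) (A : Fin (ℕ.suc m) → Subset n) →
    sumSub (ℕ.suc m) (λ K → signPow ∣ K ∣ * φ (A₀ ∪ unionOver A K)) ≤ 0ℝ

  UnionMatrixNegativeType : (n : ℕ) → (Subset n → ℝ) → Set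
  UnionMatrixNegativeType n φ =
    (x : Subset n → ℝ) → sumSub n x ≡ 0ℝ →
    sumSub n (λ U → sumSub n (λ W → x U * x W * φ (U ∪ W))) ≤ 0ℝ

module Submission where

open import Defs
open import Level using (0ℓ)
open import Data.Nat using (ℕ; zero; suc)
open import Data.Fin using (Fin; zero; suc)
open import Data.Bool using (Bool; true; false; not; _∧_; if_then_else_)
import Data.Bool.Properties as Bool
open import Data.Vec using ([]; _∷_; here; there)
open import Data.Vec.Properties using (≡-dec)
open import Data.List using (List; []; _∷_; map; _++_)
open import Data.Fin.Subset
  using (Subset; ⊥; _∪_; ∁; ⁅_⁆; ∣_∣; _∈_; _∉_; _⊆_; Nonempty; inside; outside)
open import Data.Fin.Subset.Properties
  using ( _∈?_; nonempty?; Empty-unique; ∉⊥; x∈⁅x⁆; x∈⁅y⁆⇒x≡y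
        ; x∈p⇒x∉∁p; x∉∁p⇒x∈p; ⊆-antisym)
open import Data.Product using (∃; _×_; _,_)
open import Data.Sum using (inj₁; inj₂)
open import Data.Empty using (⊥-elim)
open import Function.Base using (_∘_)
open import Function.Bundles using (_⇔_; mk⇔)
open import Relation.Nullary using (yes; no; does)
open import Relation.Nullary.Decidable using (dec-false)
open import Relation.Binary.Definitions using (DecidableEquality)
open import Relation.Binary.PropositionalEquality
open import Algebra.Bundles using (CommutativeRing)
open import Algebra.Consequences.Propositional
  using (comm∧idˡ⇒idʳ; comm∧invˡ⇒invʳ; comm∧distrˡ⇒distrʳ)

-- Write φ S = Σ_{T ∩ S = ∅} c T, where c is the Möbius inverse of S ↦ φ (V ∖ S).  Then the
-- alternating sum defining strong submodularity equals Σ c T over the T that miss A₀ and meet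
-- every Aᵢ, and the quadratic form equals Σ_T c T (Σ_{U ∩ T = ∅} x U)², whose T = ∅ term
-- vanishes when Σ x = 0.  Both are therefore ≤ 0 whenever c T ≤ 0 for every nonempty T.
-- Conversely, A₀ = ∁ T with Aᵢ = {i} for i ∈ T (resp. x = the Möbius inverse of the
-- point mass at T) isolates the single coefficient c T, so both conditions are equivalent to
-- c T ≤ 0 for all nonempty T.

_≟ˢ_ : ∀ {n} → DecidableEquality (Subset n)
_≟ˢ_ = ≡-dec Bool._≟_

disjoint : ∀ {n} → Subset n → Subset n → Bool
disjoint []      []      = true
disjoint (t ∷ T) (s ∷ S) = not (t ∧ s) ∧ disjoint T S

disjoint-comm : ∀ {n} (T S : Subset n) → disjoint T S ≡ disjoint S T
disjoint-comm []      []      = refl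
disjoint-comm (t ∷ T) (s ∷ S) = cong₂ (λ b c → not b ∧ c) (Bool.∧-comm t s) (disjoint-comm T S)

disjoint-∪ʳ : ∀ {n} (T U W : Subset n) → disjoint T (U ∪ W) ≡ disjoint T U ∧ disjoint T W
disjoint-∪ʳ []            []            []            = refl
disjoint-∪ʳ (inside  ∷ T) (inside  ∷ U) (w ∷ W)       = refl
disjoint-∪ʳ (inside  ∷ T) (outside ∷ U) (inside  ∷ W) = sym (Bool.∧-zeroʳ (disjoint T U))
disjoint-∪ʳ (inside  ∷ T) (outside ∷ U) (outside ∷ W) = disjoint-∪ʳ T U W
disjoint-∪ʳ (outside ∷ T) (u ∷ U)       (w ∷ W)       = disjoint-∪ʳ T U W

disjoint-⊥ʳ : ∀ {n} (T : Subset n) → disjoint T ⊥ ≡ true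
disjoint-⊥ʳ []      = refl
disjoint-⊥ʳ (t ∷ T) =
  trans (cong (λ b → not b ∧ disjoint T ⊥) (Bool.∧-zeroʳ t)) (disjoint-⊥ʳ T)

disjoint-⊥ˡ : ∀ {n} (S : Subset n) → disjoint ⊥ S ≡ true
disjoint-⊥ˡ S = trans (disjoint-comm ⊥ S) (disjoint-⊥ʳ S)

disjoint⇒∉ : ∀ {n} {T S : Subset n} {x} → disjoint T S ≡ true → x ∈ T → x ∉ S
disjoint⇒∉ {T = inside ∷ _} {inside ∷ _} () here here
disjoint⇒∉ {T = t ∷ _} {s ∷ _} h (there x∈T) (there x∈S) =
  disjoint⇒∉ (Bool.∧-conicalʳ (not (t ∧ s)) _ h) x∈T x∈S

∉⇒disjoint : ∀ {n} {T S : Subset n} → (∀ {x} → x ∈ T → x ∉ S) → disjoint T S ≡ true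
∉⇒disjoint {T = []}          {[]}          _ = refl
∉⇒disjoint {T = inside  ∷ _} {inside  ∷ _} h = ⊥-elim (h here here)
∉⇒disjoint {T = inside  ∷ _} {outside ∷ _} h =
  ∉⇒disjoint (λ x∈T x∈S → h (there x∈T) (there x∈S))
∉⇒disjoint {T = outside ∷ _} {s ∷ _}       h =
  ∉⇒disjoint (λ x∈T x∈S → h (there x∈T) (there x∈S))

∈∩⇒¬disjoint : ∀ {n} {T S : Subset n} {x} → x ∈ T → x ∈ S → disjoint T S ≡ false
∈∩⇒¬disjoint x∈T x∈S = Bool.¬-not (λ h → disjoint⇒∉ h x∈T x∈S)

¬disjoint⇒∈∩ : ∀ {n} {T S : Subset n} → disjoint T S ≡ false → ∃ λ x → x ∈ T × x ∈ S
¬disjoint⇒∈∩ {T = []} {[]} ()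
¬disjoint⇒∈∩ {T = inside ∷ _} {inside ∷ _} _ = zero , here , here
¬disjoint⇒∈∩ {T = inside ∷ _} {outside ∷ _} h with ¬disjoint⇒∈∩ h
... | x , x∈T , x∈S = suc x , there x∈T , there x∈S
¬disjoint⇒∈∩ {T = outside ∷ _} {s ∷ _} h with ¬disjoint⇒∈∩ h
... | x , x∈T , x∈S = suc x , there x∈T , there x∈S

meetsAll : ∀ {n k} → Subset n → (Fin k → Subset n) → Bool
meetsAll {k = zero}  T A = true
meetsAll {k = suc k} T A = not (disjoint T (A zero)) ∧ meetsAll T (A ∘ suc)

meetsAll⁺ : ∀ {n k} {T : Subset n} {A : Fin k → Subset n} →
  (∀ i → disjoint T (A i) ≡ false) → meetsAll T A ≡ true
meetsAll⁺ {k = zero}  meets = refl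
meetsAll⁺ {k = suc k} meets = cong₂ (λ b c → not b ∧ c) (meets zero) (meetsAll⁺ (meets ∘ suc))

meetsAll⁻ : ∀ {n k} {T : Subset n} {A : Fin k → Subset n} →
  meetsAll T A ≡ true → ∀ i → disjoint T (A i) ≡ false
meetsAll⁻ {T = T} {A} h zero    =
  Bool.not-injective (Bool.∧-conicalˡ (not (disjoint T (A zero))) _ h)
meetsAll⁻ {T = T} {A} h (suc i) =
  meetsAll⁻ (Bool.∧-conicalʳ (not (disjoint T (A zero))) _ h) i

meetsAll-⊥ : ∀ {n k} (A : Fin (suc k) → Subset n) → meetsAll ⊥ A ≡ false
meetsAll-⊥ A = cong (λ b → not b ∧ meetsAll ⊥ (A ∘ suc)) (disjoint-⊥ˡ (A zero))

-- Aᵢ = {i} for i ∈ T₀; the remaining indices only need some set meeting T₀.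
separating : ∀ {n} → Subset n → Fin n → Subset n
separating T₀ i = if does (i ∈? T₀) then ⁅ i ⁆ else T₀

pinnedBy : ∀ {n} → Subset n → Subset n → Bool
pinnedBy T₀ T = disjoint T (∁ T₀) ∧ meetsAll T (separating T₀)

pinnedBy-self : ∀ {n} {T₀ : Subset n} → Nonempty T₀ → pinnedBy T₀ T₀ ≡ true
pinnedBy-self {T₀ = T₀} (x , x∈T₀) =
  cong₂ _∧_ (∉⇒disjoint {T = T₀} x∈p⇒x∉∁p) (meetsAll⁺ meets)
  where
  meets : ∀ i → disjoint T₀ (separating T₀ i) ≡ false
  meets i with i ∈? T₀
  ... | yes i∈T₀ = ∈∩⇒¬disjoint i∈T₀ (x∈⁅x⁆ i)
  ... | no  _    = ∈∩⇒¬disjoint x∈T₀ x∈T₀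

pinnedBy⇒≡ : ∀ {n} {T₀ T : Subset n} → pinnedBy T₀ T ≡ true → T ≡ T₀
pinnedBy⇒≡ {T₀ = T₀} {T} h = ⊆-antisym T⊆T₀ T₀⊆T
  where
  T⊆T₀ : T ⊆ T₀
  T⊆T₀ x∈T = x∉∁p⇒x∈p (disjoint⇒∉ (Bool.∧-conicalˡ _ _ h) x∈T)
  T₀⊆T : T₀ ⊆ T
  T₀⊆T {i} i∈T₀ with i ∈? T₀ | meetsAll⁻ (Bool.∧-conicalʳ (disjoint T (∁ T₀)) _ h) i
  ... | yes _    | meets with ¬disjoint⇒∈∩ meets
  ...   | x , x∈T , x∈⁅i⁆ = subst (_∈ T) (x∈⁅y⁆⇒x≡y i x∈⁅i⁆) x∈T
  T₀⊆T {i} i∈T₀ | no i∉T₀ | _ = ⊥-elim (i∉T₀ i∈T₀)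

pinnedBy≡≟ : ∀ {n} {T₀ : Subset n} → Nonempty T₀ → ∀ T → pinnedBy T₀ T ≡ does (T ≟ˢ T₀)
pinnedBy≡≟ {T₀ = T₀} ne T with T ≟ˢ T₀
... | yes refl = pinnedBy-self ne
... | no  T≢T₀ = Bool.¬-not (T≢T₀ ∘ pinnedBy⇒≡)

module _ (R : RealField) where
  open RealField R

  commutativeRing : CommutativeRing 0ℓ 0ℓ
  commutativeRing = record
    { isCommutativeRing = record
      { isRing = record
        { +-isAbelianGroup = record
          { isGroup = record
            { isMonoid = record
              { isSemigroup = record
                { isMagma = record { isEquivalence = isEquivalence ; ∙-cong = cong₂ _+_ }
                ; assoc   = +-assoc
                }
              ; identity = +-idˡ , comm∧idˡ⇒idʳ +-comm +-idˡ
              }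
            ; inverse = +-invˡ , comm∧invˡ⇒invʳ +-comm +-invˡ
            ; ⁻¹-cong = cong -_
            }
          ; comm = +-comm
          }
        ; *-cong     = cong₂ _*_
        ; *-assoc    = *-assoc
        ; *-identity = *-idˡ , comm∧idˡ⇒idʳ *-comm *-idˡ
        ; distrib    = distribˡ , comm∧distrˡ⇒distrʳ *-comm distribˡ
        }
      ; *-comm = *-comm
      }
    }

  open CommutativeRing commutativeRing
    using ( _-_; +-identityʳ; *-identityʳ; distribʳ; zeroˡ; zeroʳ; -‿inverseʳ; ring
          ; +-commutativeSemigroup; *-commutativeSemigroup)
  open import Algebra.Properties.Ring ring
    using (-‿distribˡ-*; -‿distribʳ-*; -‿involutive; -1*x≈-x; //-rightDividesˡ)
  open import Algebra.Properties.CommutativeSemigroup +-commutativeSemigroup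
    using () renaming (interchange to +-interchange)
  open import Algebra.Properties.CommutativeSemigroup *-commutativeSemigroup
    using (x∙yz≈y∙xz; interchange)
  open ≡-Reasoning

  neg-nonpos : ∀ {a} → 0ℝ ≤ a → - a ≤ 0ℝ
  neg-nonpos {a} 0≤a = subst₂ _≤_ (+-idˡ (- a)) (-‿inverseʳ a) (+-mono-≤ (- a) 0≤a)

  neg-nonneg : ∀ {a} → a ≤ 0ℝ → 0ℝ ≤ - a
  neg-nonneg {a} a≤0 = subst₂ _≤_ (-‿inverseʳ a) (+-idˡ (- a)) (+-mono-≤ (- a) a≤0)

  *-nonpos-nonneg : ∀ {a b} → a ≤ 0ℝ → 0ℝ ≤ b → a * b ≤ 0ℝ
  *-nonpos-nonneg {a} {b} a≤0 0≤b =
    subst (_≤ 0ℝ) -[-a*b]≡a*b (neg-nonpos (*-nonneg (neg-nonneg a≤0) 0≤b))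
    where
    -[-a*b]≡a*b : - (- a * b) ≡ a * b
    -[-a*b]≡a*b = trans (cong -_ (sym (-‿distribˡ-* a b))) (-‿involutive (a * b))

  square-nonneg : ∀ a → 0ℝ ≤ a * a
  square-nonneg a with ≤-total 0ℝ a
  ... | inj₁ 0≤a = *-nonneg 0≤a 0≤a
  ... | inj₂ a≤0 = subst (0ℝ ≤_) -a*-a≡a*a (*-nonneg (neg-nonneg a≤0) (neg-nonneg a≤0))
    where
    -a*-a≡a*a : - a * - a ≡ a * a
    -a*-a≡a*a = begin
      - a * - a     ≡⟨ -‿distribˡ-* a (- a) ⟨
      - (a * - a)   ≡⟨ cong -_ (-‿distribʳ-* a a) ⟨
      - (- (a * a)) ≡⟨ -‿involutive (a * a) ⟩
      a * a         ∎

  +-nonpos : ∀ {a b} → a ≤ 0ℝ → b ≤ 0ℝ → a + b ≤ 0ℝ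
  +-nonpos {a} {b} a≤0 b≤0 = ≤-trans (subst (a + b ≤_) (+-idˡ b) (+-mono-≤ b a≤0)) b≤0

  𝟙 : Bool → ℝ
  𝟙 true  = 1ℝ
  𝟙 false = 0ℝ

  𝟙-nonneg : ∀ b → 0ℝ ≤ 𝟙 b
  𝟙-nonneg true  = subst (0ℝ ≤_) (*-idˡ 1ℝ) (square-nonneg 1ℝ)
  𝟙-nonneg false = ≤-refl 0ℝ

  𝟙-∧ : ∀ a b → 𝟙 (a ∧ b) ≡ 𝟙 a * 𝟙 b
  𝟙-∧ true  b = sym (*-idˡ (𝟙 b))
  𝟙-∧ false b = sym (zeroˡ (𝟙 b))

  𝟙-idem : ∀ b → 𝟙 b * 𝟙 b ≡ 𝟙 b
  𝟙-idem b = trans (sym (𝟙-∧ b b)) (cong 𝟙 (Bool.∧-idem b))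

  module _ {A : Set} where

    sumL-cong : ∀ (xs : List A) {f g : A → ℝ} → (∀ a → f a ≡ g a) → sumL R xs f ≡ sumL R xs g
    sumL-cong []       f≗g = refl
    sumL-cong (x ∷ xs) f≗g = cong₂ _+_ (f≗g x) (sumL-cong xs f≗g)

    sumL-zero : ∀ (xs : List A) {f : A → ℝ} → (∀ a → f a ≡ 0ℝ) → sumL R xs f ≡ 0ℝ
    sumL-zero []       f≗0 = refl
    sumL-zero (x ∷ xs) f≗0 = trans (cong₂ _+_ (f≗0 x) (sumL-zero xs f≗0)) (+-idˡ 0ℝ)

    sumL-*0 : ∀ (xs : List A) (f : A → ℝ) → sumL R xs (λ a → f a * 0ℝ) ≡ 0ℝ
    sumL-*0 xs f = sumL-zero xs (λ a → zeroʳ (f a))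

    sumL-+ : ∀ (xs : List A) (f g : A → ℝ) →
      sumL R xs (λ a → f a + g a) ≡ sumL R xs f + sumL R xs g
    sumL-+ []       f g = sym (+-idˡ 0ℝ)
    sumL-+ (x ∷ xs) f g =
      trans (cong ((f x + g x) +_) (sumL-+ xs f g)) (+-interchange (f x) (g x) _ _)

    sumL-*ˡ : ∀ (xs : List A) (c : ℝ) (f : A → ℝ) → sumL R xs (λ a → c * f a) ≡ c * sumL R xs f
    sumL-*ˡ []       c f = sym (zeroʳ c)
    sumL-*ˡ (x ∷ xs) c f = trans (cong (c * f x +_) (sumL-*ˡ xs c f)) (sym (distribˡ c (f x) _))

    sumL-*ʳ : ∀ (xs : List A) (c : ℝ) (f : A → ℝ) → sumL R xs (λ a → f a * c) ≡ sumL R xs f * c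
    sumL-*ʳ xs c f =
      trans (sumL-cong xs (λ a → *-comm (f a) c)) (trans (sumL-*ˡ xs c f) (*-comm c _))

    sumL-nonpos : ∀ (xs : List A) {f : A → ℝ} → (∀ a → f a ≤ 0ℝ) → sumL R xs f ≤ 0ℝ
    sumL-nonpos []       f≤0 = ≤-refl 0ℝ
    sumL-nonpos (x ∷ xs) f≤0 = +-nonpos (f≤0 x) (sumL-nonpos xs f≤0)

    sumL-++ : ∀ (xs ys : List A) (f : A → ℝ) → sumL R (xs ++ ys) f ≡ sumL R xs f + sumL R ys f
    sumL-++ []       ys f = sym (+-idˡ _)
    sumL-++ (x ∷ xs) ys f = trans (cong (f x +_) (sumL-++ xs ys f)) (sym (+-assoc (f x) _ _))

  sumL-map : ∀ {A B : Set} (g : A → B) (xs : List A) (f : B → ℝ) →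
    sumL R (map g xs) f ≡ sumL R xs (f ∘ g)
  sumL-map g []       f = refl
  sumL-map g (x ∷ xs) f = cong (f (g x) +_) (sumL-map g xs f)

  sumL-swap : ∀ {A B : Set} (xs : List A) (ys : List B) (f : A → B → ℝ) →
    sumL R xs (λ a → sumL R ys (f a)) ≡ sumL R ys (λ b → sumL R xs (λ a → f a b))
  sumL-swap []       ys f = sym (sumL-zero ys (λ _ → refl))
  sumL-swap (x ∷ xs) ys f =
    trans (cong (sumL R ys (f x) +_) (sumL-swap xs ys f)) (sym (sumL-+ ys (f x) _))

  sumL-*-sumL : ∀ {A B : Set} (xs : List A) (ys : List B) (f : A → ℝ) (g : B → ℝ) →
    sumL R xs f * sumL R ys g ≡ sumL R xs (λ a → sumL R ys (λ b → f a * g b))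
  sumL-*-sumL xs ys f g =
    trans (sym (sumL-*ʳ xs _ f)) (sumL-cong xs (λ a → sym (sumL-*ˡ ys (f a) g)))

  sumSub-suc : ∀ n (f : Subset (suc n) → ℝ) →
    sumSub R (suc n) f ≡ sumSub R n (f ∘ (inside ∷_)) + sumSub R n (f ∘ (outside ∷_))
  sumSub-suc n f = trans (sumL-++ (map (inside ∷_) (allSubsets n)) _ f)
    (cong₂ _+_ (sumL-map (inside ∷_) (allSubsets n) f) (sumL-map (outside ∷_) (allSubsets n) f))

  sumSub-pointMass : ∀ {n} (f : Subset n → ℝ) (T₀ : Subset n) →
    sumSub R n (λ T → f T * 𝟙 (does (T ≟ˢ T₀))) ≡ f T₀
  sumSub-pointMass {zero}  f [] = trans (+-identityʳ _) (*-identityʳ (f []))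
  sumSub-pointMass {suc n} f (inside ∷ T₀) =
    trans (sumSub-suc n _)
      (trans (cong₂ _+_ (sumSub-pointMass (f ∘ (inside ∷_)) T₀) (sumL-*0 (allSubsets n) _))
             (+-identityʳ _))
  sumSub-pointMass {suc n} f (outside ∷ T₀) =
    trans (sumSub-suc n _)
      (trans (cong₂ _+_ (sumL-*0 (allSubsets n) _) (sumSub-pointMass (f ∘ (outside ∷_)) T₀))
             (+-idˡ _))

  disjointSum : ∀ {n} → (Subset n → ℝ) → Subset n → ℝ
  disjointSum {n} x S = sumSub R n (λ T → x T * 𝟙 (disjoint T S))

  disjointSum-⊥ : ∀ {n} (x : Subset n → ℝ) → disjointSum x ⊥ ≡ sumSub R n x
  disjointSum-⊥ {n} x = sumL-cong (allSubsets n)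
    (λ U → trans (cong (λ b → x U * 𝟙 b) (disjoint-⊥ʳ U)) (*-identityʳ (x U)))

  -- The Möbius inverse of S ↦ φ (V ∖ S) on the subset lattice.
  coMöbius : ∀ {n} → (Subset n → ℝ) → Subset n → ℝ
  coMöbius {zero}  φ []            = φ []
  coMöbius {suc n} φ (inside  ∷ T) = coMöbius (φ ∘ (outside ∷_)) T - coMöbius (φ ∘ (inside ∷_)) T
  coMöbius {suc n} φ (outside ∷ T) = coMöbius (φ ∘ (inside ∷_)) T

  disjointSum-coMöbius : ∀ {n} (φ : Subset n → ℝ) S → disjointSum (coMöbius φ) S ≡ φ S
  disjointSum-coMöbius {zero}  φ [] = trans (+-identityʳ _) (*-identityʳ (φ []))
  disjointSum-coMöbius {suc n} φ (inside ∷ S) =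
    trans (sumSub-suc n _)
      (trans (cong₂ _+_ (sumL-*0 (allSubsets n) _) (disjointSum-coMöbius (φ ∘ (inside ∷_)) S))
             (+-idˡ _))
  disjointSum-coMöbius {suc n} φ (outside ∷ S) = begin
    disjointSum (coMöbius φ) (outside ∷ S)
      ≡⟨ sumSub-suc n _ ⟩
    sumSub R n (λ T → (c₀ T - c₁ T) * 𝟙 (d T)) + sumSub R n (λ T → c₁ T * 𝟙 (d T))
      ≡⟨ sumL-+ (allSubsets n) _ _ ⟨
    sumSub R n (λ T → (c₀ T - c₁ T) * 𝟙 (d T) + c₁ T * 𝟙 (d T))
      ≡⟨ sumL-cong (allSubsets n) (λ T → trans (sym (distribʳ (𝟙 (d T)) (c₀ T - c₁ T) (c₁ T)))
                                               (cong (_* 𝟙 (d T)) (//-rightDividesˡ (c₁ T) (c₀ T)))) ⟩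
    disjointSum c₀ S
      ≡⟨ disjointSum-coMöbius (φ ∘ (outside ∷_)) S ⟩
    φ (outside ∷ S) ∎
    where
    c₀ = coMöbius (φ ∘ (outside ∷_))
    c₁ = coMöbius (φ ∘ (inside ∷_))
    d  = λ T → disjoint T S

  sumL-expand-coMöbius : ∀ {A : Set} {n} (xs : List A) (c : A → ℝ) (g : A → Subset n) φ →
    sumL R xs (λ a → c a * φ (g a)) ≡
    sumSub R n (λ T → coMöbius φ T * sumL R xs (λ a → c a * 𝟙 (disjoint T (g a))))
  sumL-expand-coMöbius {n = n} xs c g φ = begin
    sumL R xs (λ a → c a * φ (g a))
      ≡⟨ sumL-cong xs (λ a → cong (c a *_) (disjointSum-coMöbius φ (g a))) ⟨
    sumL R xs (λ a → c a * sumSub R n (λ T → D T * 𝟙 (disjoint T (g a))))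
      ≡⟨ sumL-cong xs (λ a → sumL-*ˡ (allSubsets n) (c a) _) ⟨
    sumL R xs (λ a → sumSub R n (λ T → c a * (D T * 𝟙 (disjoint T (g a)))))
      ≡⟨ sumL-swap xs (allSubsets n) _ ⟩
    sumSub R n (λ T → sumL R xs (λ a → c a * (D T * 𝟙 (disjoint T (g a)))))
      ≡⟨ sumL-cong (allSubsets n) (λ T → sumL-cong xs (λ a → x∙yz≈y∙xz (c a) (D T) _)) ⟩
    sumSub R n (λ T → sumL R xs (λ a → D T * (c a * 𝟙 (disjoint T (g a)))))
      ≡⟨ sumL-cong (allSubsets n) (λ T → sumL-*ˡ xs (D T) _) ⟩
    sumSub R n (λ T → D T * sumL R xs (λ a → c a * 𝟙 (disjoint T (g a)))) ∎
    where D = coMöbius φ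

  inclusion-exclusion-step : ∀ {A : Set} (xs : List A) b (f : A → ℝ) (m : A → Bool) →
    sumL R xs (λ a → - 1ℝ * f a * 𝟙 (b ∧ m a)) + sumL R xs (λ a → f a * 𝟙 (m a)) ≡
    𝟙 (not b) * sumL R xs (λ a → f a * 𝟙 (m a))
  inclusion-exclusion-step xs true f m = begin
    sumL R xs (λ a → - 1ℝ * f a * 𝟙 (m a)) + sumL R xs (λ a → f a * 𝟙 (m a))
      ≡⟨ sumL-+ xs _ _ ⟨
    sumL R xs (λ a → - 1ℝ * f a * 𝟙 (m a) + f a * 𝟙 (m a))
      ≡⟨ sumL-zero xs cancel ⟩
    0ℝ
      ≡⟨ zeroˡ _ ⟨
    0ℝ * sumL R xs (λ a → f a * 𝟙 (m a)) ∎
    where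
    cancel : ∀ a → - 1ℝ * f a * 𝟙 (m a) + f a * 𝟙 (m a) ≡ 0ℝ
    cancel a = begin
      - 1ℝ * f a * 𝟙 (m a) + f a * 𝟙 (m a) ≡⟨ distribʳ (𝟙 (m a)) _ _ ⟨
      (- 1ℝ * f a + f a) * 𝟙 (m a)         ≡⟨ cong (λ y → (y + f a) * 𝟙 (m a)) (-1*x≈-x (f a)) ⟩
      (- f a + f a) * 𝟙 (m a)              ≡⟨ cong (_* 𝟙 (m a)) (+-invˡ (f a)) ⟩
      0ℝ * 𝟙 (m a)                         ≡⟨ zeroˡ _ ⟩
      0ℝ                                   ∎
  inclusion-exclusion-step xs false f m =
    trans (cong₂ _+_ (sumL-*0 xs _) (sym (*-idˡ _))) (+-idˡ _)

  inclusion-exclusion : ∀ k {n} (A : Fin k → Subset n) (T : Subset n) →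
    sumSub R k (λ K → signPow R ∣ K ∣ * 𝟙 (disjoint T (unionOver A K))) ≡ 𝟙 (meetsAll T A)
  inclusion-exclusion zero A T =
    trans (+-identityʳ _) (trans (*-idˡ _) (cong 𝟙 (disjoint-⊥ʳ T)))
  inclusion-exclusion (suc k) A T = begin
    sumSub R (suc k) (λ K → signPow R ∣ K ∣ * 𝟙 (disjoint T (unionOver A K)))
      ≡⟨ sumSub-suc k _ ⟩
    sumSub R k (λ K → - 1ℝ * s K * 𝟙 (disjoint T (A zero ∪ U K)))
      + sumSub R k (λ K → s K * 𝟙 (disjoint T (⊥ ∪ U K)))
      ≡⟨ cong₂ _+_
           (sumL-cong (allSubsets k) (λ K → cong (λ b → - 1ℝ * s K * 𝟙 b) (disjoint-∪ʳ T _ _)))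
           (sumL-cong (allSubsets k) (λ K → cong (λ b → s K * 𝟙 b) (⊥-unit K))) ⟩
    sumSub R k (λ K → - 1ℝ * s K * 𝟙 (d₀ ∧ d K)) + sumSub R k (λ K → s K * 𝟙 (d K))
      ≡⟨ inclusion-exclusion-step (allSubsets k) d₀ s d ⟩
    𝟙 (not d₀) * sumSub R k (λ K → s K * 𝟙 (d K))
      ≡⟨ cong (𝟙 (not d₀) *_) (inclusion-exclusion k (A ∘ suc) T) ⟩
    𝟙 (not d₀) * 𝟙 (meetsAll T (A ∘ suc))
      ≡⟨ 𝟙-∧ (not d₀) _ ⟨
    𝟙 (meetsAll T A) ∎
    where
    s = λ (K : Subset k) → signPow R ∣ K ∣
    U = unionOver (A ∘ suc)
    d = λ K → disjoint T (U K)
    d₀ = disjoint T (A zero)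
    ⊥-unit : ∀ K → disjoint T (⊥ ∪ U K) ≡ d K
    ⊥-unit K = trans (disjoint-∪ʳ T ⊥ (U K)) (cong (_∧ d K) (disjoint-⊥ʳ T))

  strongSubmodularSum-coMöbius : ∀ {k n} (φ : Subset n → ℝ) A₀ (A : Fin k → Subset n) →
    sumSub R k (λ K → signPow R ∣ K ∣ * φ (A₀ ∪ unionOver A K)) ≡
    sumSub R n (λ T → coMöbius φ T * 𝟙 (disjoint T A₀ ∧ meetsAll T A))
  strongSubmodularSum-coMöbius {k} {n} φ A₀ A =
    trans (sumL-expand-coMöbius (allSubsets k) s (λ K → A₀ ∪ unionOver A K) φ)
          (sumL-cong (allSubsets n) (λ T → cong (coMöbius φ T *_) (signedSum T)))
    where
    s = λ (K : Subset k) → signPow R ∣ K ∣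
    signedSum : ∀ T → sumSub R k (λ K → s K * 𝟙 (disjoint T (A₀ ∪ unionOver A K))) ≡
                      𝟙 (disjoint T A₀ ∧ meetsAll T A)
    signedSum T = begin
      sumSub R k (λ K → s K * 𝟙 (disjoint T (A₀ ∪ unionOver A K)))
        ≡⟨ sumL-cong (allSubsets k) (λ K → cong (λ b → s K * 𝟙 b) (disjoint-∪ʳ T A₀ _)) ⟩
      sumSub R k (λ K → s K * 𝟙 (d₀ ∧ disjoint T (unionOver A K)))
        ≡⟨ sumL-cong (allSubsets k)
             (λ K → trans (cong (s K *_) (𝟙-∧ d₀ _)) (x∙yz≈y∙xz (s K) _ _)) ⟩
      sumSub R k (λ K → 𝟙 d₀ * (s K * 𝟙 (disjoint T (unionOver A K))))
        ≡⟨ sumL-*ˡ (allSubsets k) _ _ ⟩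
      𝟙 d₀ * sumSub R k (λ K → s K * 𝟙 (disjoint T (unionOver A K)))
        ≡⟨ cong (𝟙 d₀ *_) (inclusion-exclusion k A T) ⟩
      𝟙 d₀ * 𝟙 (meetsAll T A)
        ≡⟨ 𝟙-∧ d₀ _ ⟨
      𝟙 (d₀ ∧ meetsAll T A) ∎
      where d₀ = disjoint T A₀

  unionForm-coMöbius : ∀ {n} (φ x : Subset n → ℝ) →
    sumSub R n (λ U → sumSub R n (λ W → x U * x W * φ (U ∪ W))) ≡
    sumSub R n (λ T → coMöbius φ T * (disjointSum x T * disjointSum x T))
  unionForm-coMöbius {n} φ x = begin
    sumSub R n (λ U → sumSub R n (λ W → x U * x W * φ (U ∪ W)))
      ≡⟨ sumL-cong (allSubsets n)
           (λ U → sumL-expand-coMöbius (allSubsets n) (λ W → x U * x W) (U ∪_) φ) ⟩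
    sumSub R n (λ U → sumSub R n (λ T → D T * q T U))
      ≡⟨ sumL-swap (allSubsets n) (allSubsets n) _ ⟩
    sumSub R n (λ T → sumSub R n (λ U → D T * q T U))
      ≡⟨ sumL-cong (allSubsets n) (λ T → sumL-*ˡ (allSubsets n) (D T) (q T)) ⟩
    sumSub R n (λ T → D T * sumSub R n (q T))
      ≡⟨ sumL-cong (allSubsets n) (λ T → cong (D T *_) (square T)) ⟩
    sumSub R n (λ T → D T * (disjointSum x T * disjointSum x T)) ∎
    where
    D = coMöbius φ
    q : Subset n → Subset n → ℝ
    q T U = sumSub R n (λ W → x U * x W * 𝟙 (disjoint T (U ∪ W)))
    factor : ∀ T U W → x U * x W * 𝟙 (disjoint T (U ∪ W)) ≡
                       x U * 𝟙 (disjoint U T) * (x W * 𝟙 (disjoint W T))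
    factor T U W = begin
      x U * x W * 𝟙 (disjoint T (U ∪ W))
        ≡⟨ cong (λ b → x U * x W * 𝟙 b) (disjoint-∪ʳ T U W) ⟩
      x U * x W * 𝟙 (disjoint T U ∧ disjoint T W)
        ≡⟨ cong (x U * x W *_) (𝟙-∧ (disjoint T U) _) ⟩
      x U * x W * (𝟙 (disjoint T U) * 𝟙 (disjoint T W))
        ≡⟨ cong₂ (λ b c → x U * x W * (𝟙 b * 𝟙 c)) (disjoint-comm T U) (disjoint-comm T W) ⟩
      x U * x W * (𝟙 (disjoint U T) * 𝟙 (disjoint W T))
        ≡⟨ interchange (x U) (x W) _ _ ⟩
      x U * 𝟙 (disjoint U T) * (x W * 𝟙 (disjoint W T)) ∎
    square : ∀ T → sumSub R n (q T) ≡ disjointSum x T * disjointSum x T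
    square T = trans (sumL-cong (allSubsets n) (λ U → sumL-cong (allSubsets n) (factor T U)))
                     (sym (sumL-*-sumL (allSubsets n) (allSubsets n) _ _))

  NonpositiveCoMöbius : (n : ℕ) → (Subset n → ℝ) → Set
  NonpositiveCoMöbius n φ = ∀ T → Nonempty T → coMöbius φ T ≤ 0ℝ

  coMöbius-weightedSum-nonpos : ∀ {n} {φ : Subset n → ℝ} → NonpositiveCoMöbius n φ →
    (w : Subset n → ℝ) → (∀ T → 0ℝ ≤ w T) → w ⊥ ≡ 0ℝ →
    sumSub R n (λ T → coMöbius φ T * w T) ≤ 0ℝ
  coMöbius-weightedSum-nonpos {n} {φ} c≤0 w w≥0 w⊥≡0 = sumL-nonpos (allSubsets n) term
    where
    term : ∀ T → coMöbius φ T * w T ≤ 0ℝ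
    term T with nonempty? T
    ... | yes ne = *-nonpos-nonneg (c≤0 T ne) (w≥0 T)
    ... | no  e  rewrite Empty-unique e =
      subst (_≤ 0ℝ) (sym (trans (cong (coMöbius φ ⊥ *_) w⊥≡0) (zeroʳ _))) (≤-refl 0ℝ)

  nonpositiveCoMöbius⇒stronglySubmodular : ∀ {n} {φ : Subset n → ℝ} →
    NonpositiveCoMöbius n φ → StronglySubmodular R n φ
  nonpositiveCoMöbius⇒stronglySubmodular {φ = φ} c≤0 m A₀ A =
    subst (_≤ 0ℝ) (sym (strongSubmodularSum-coMöbius φ A₀ A))
      (coMöbius-weightedSum-nonpos c≤0 w (𝟙-nonneg ∘ pinned) w⊥≡0)
    where
    pinned = λ T → disjoint T A₀ ∧ meetsAll T A
    w = 𝟙 ∘ pinned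
    w⊥≡0 : w ⊥ ≡ 0ℝ
    w⊥≡0 = cong 𝟙 (trans (cong (disjoint ⊥ A₀ ∧_) (meetsAll-⊥ A)) (Bool.∧-zeroʳ _))

  stronglySubmodular⇒nonpositiveCoMöbius : ∀ {n} {φ : Subset n → ℝ} →
    StronglySubmodular R n φ → NonpositiveCoMöbius n φ
  stronglySubmodular⇒nonpositiveCoMöbius {zero}      ss T  (() , _)
  stronglySubmodular⇒nonpositiveCoMöbius {suc m} {φ} ss T₀ ne =
    subst (_≤ 0ℝ) isolate (ss m (∁ T₀) (separating T₀))
    where
    isolate : sumSub R (suc m) (λ K → signPow R ∣ K ∣ * φ (∁ T₀ ∪ unionOver (separating T₀) K)) ≡
              coMöbius φ T₀
    isolate = begin
      sumSub R (suc m) (λ K → signPow R ∣ K ∣ * φ (∁ T₀ ∪ unionOver (separating T₀) K))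
        ≡⟨ strongSubmodularSum-coMöbius φ (∁ T₀) (separating T₀) ⟩
      sumSub R (suc m) (λ T → coMöbius φ T * 𝟙 (pinnedBy T₀ T))
        ≡⟨ sumL-cong (allSubsets (suc m))
             (λ T → cong (λ b → coMöbius φ T * 𝟙 b) (pinnedBy≡≟ ne T)) ⟩
      sumSub R (suc m) (λ T → coMöbius φ T * 𝟙 (does (T ≟ˢ T₀)))
        ≡⟨ sumSub-pointMass (coMöbius φ) T₀ ⟩
      coMöbius φ T₀ ∎

  nonpositiveCoMöbius⇒negativeType : ∀ {n} {φ : Subset n → ℝ} →
    NonpositiveCoMöbius n φ → UnionMatrixNegativeType R n φ
  nonpositiveCoMöbius⇒negativeType {φ = φ} c≤0 x Σx≡0 =
    subst (_≤ 0ℝ) (sym (unionForm-coMöbius φ x))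
      (coMöbius-weightedSum-nonpos c≤0 _ (λ T → square-nonneg (disjointSum x T))
        (trans (cong (λ y → y * y) (trans (disjointSum-⊥ x) Σx≡0)) (zeroˡ 0ℝ)))

  negativeType⇒nonpositiveCoMöbius : ∀ {n} {φ : Subset n → ℝ} →
    UnionMatrixNegativeType R n φ → NonpositiveCoMöbius n φ
  negativeType⇒nonpositiveCoMöbius {n} {φ} neg T₀ (y , y∈T₀) =
    subst (_≤ 0ℝ) isolate (neg x Σx≡0)
    where
    δ : Subset n → ℝ
    δ T = 𝟙 (does (T ≟ˢ T₀))
    x : Subset n → ℝ
    x = coMöbius δ
    ⊥≢T₀ : ⊥ ≢ T₀
    ⊥≢T₀ ⊥≡T₀ = ∉⊥ (subst (y ∈_) (sym ⊥≡T₀) y∈T₀)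
    Σx≡0 : sumSub R n x ≡ 0ℝ
    Σx≡0 = begin
      sumSub R n x      ≡⟨ disjointSum-⊥ x ⟨
      disjointSum x ⊥   ≡⟨ disjointSum-coMöbius δ ⊥ ⟩
      δ ⊥               ≡⟨ cong 𝟙 (dec-false (⊥ ≟ˢ T₀) ⊥≢T₀) ⟩
      0ℝ                ∎
    isolate : sumSub R n (λ U → sumSub R n (λ W → x U * x W * φ (U ∪ W))) ≡ coMöbius φ T₀
    isolate = begin
      sumSub R n (λ U → sumSub R n (λ W → x U * x W * φ (U ∪ W)))
        ≡⟨ unionForm-coMöbius φ x ⟩
      sumSub R n (λ T → coMöbius φ T * (disjointSum x T * disjointSum x T))
        ≡⟨ sumL-cong (allSubsets n)
             (λ T → cong (λ y → coMöbius φ T * (y * y)) (disjointSum-coMöbius δ T)) ⟩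
      sumSub R n (λ T → coMöbius φ T * (δ T * δ T))
        ≡⟨ sumL-cong (allSubsets n) (λ T → cong (coMöbius φ T *_) (𝟙-idem (does (T ≟ˢ T₀)))) ⟩
      sumSub R n (λ T → coMöbius φ T * δ T)
        ≡⟨ sumSub-pointMass (coMöbius φ) T₀ ⟩
      coMöbius φ T₀ ∎

-- Both conditions are unchanged by adding a constant to φ.
mainTheorem19 : (R : RealField) (n : ℕ) (φ : Subset n → RealField.ℝ R) →
    φ ⊥ ≡ RealField.0ℝ R →
    StronglySubmodular R n φ ⇔ UnionMatrixNegativeType R n φ
mainTheorem19 R n φ _ = mk⇔
  (nonpositiveCoMöbius⇒negativeType R ∘ stronglySubmodular⇒nonpositiveCoMöbius R {φ = φ})
  (nonpositiveCoMöbius⇒stronglySubmodular R ∘ negativeType⇒nonpositiveCoMöbius R {φ = φ})
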